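{- If $G$ is a graph with $n$ vertices and $m$ edges, then $\mu(G)\le \mu(L(n,m))$.
   Context: For a graph $G$, $\mu(G)=2\#(G,K_3)+\#(G,P_3)$, where $\#(G,K_3)$ is the number of 3-subsets of $V(G)$ inducing a triangle and $\#(G,P_3)$ is the number of 3-subsets inducing a path with two edges. The lex graph $L(n,m)$ has vertex set $[n]=\{1,\dots,n\}$ and edge set the first $m$ elements of $\binom{[n]}{2}$ in lex order, where $A<B$ iff $\min(A\triangle B)\in A$; thus the edges are taken in the order $\{1,2\},\{1,3\},\dots,\{1,n\},\{2,3\},\dots,\{2,n\},\{3,4\},\dots$. -}

module Defs where

open import Data.Nat using (ℕ; zero; suc; _+_; _∸_; _<ᵇ_)
open import Data.Bool using (Bool; true; false; if_then_else_; _∧_; not)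
open import Data.Fin using (Fin; toℕ; _<_)
open import Data.Nat.ListAction using (sum)
open import Data.List using (List; []; _∷_; map; allFin; filter; length; concatMap)
open import Relation.Binary.PropositionalEquality using (_≡_; refl)
open import Data.Bool using (T)
open import Data.Unit using (tt)
open import Data.Empty using (⊥-elim)
open import Data.Nat.Properties using (<-asym; <ᵇ⇒<)

record Graph (n : ℕ) : Set where
  field
    adj   : Fin n → Fin n → Bool
    sym   : ∀ i j → adj i j ≡ adj j i
    irrefl : ∀ i → adj i i ≡ false
open Graph public

record Pair (n : ℕ) : Set where
  constructor pair
  field
    fst snd : Fin n

pairs : (n : ℕ) → List (Pair n)
pairs n = concatMap (λ i → map (pair i)
            (filter (λ j → Data.Fin._<?_ i j) (allFin n))) (allFin n)

record Triple (n : ℕ) : Set where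
  constructor triple
  field
    a b c : Fin n

triples : (n : ℕ) → List (Triple n)
triples n = concatMap (λ p → map (triple (Pair.fst p) (Pair.snd p))
              (filter (λ k → Data.Fin._<?_ (Pair.snd p) k) (allFin n))) (pairs n)

b2n : Bool → ℕ
b2n true = 1
b2n false = 0

edgeCount : ∀ {n} → Graph n → ℕ
edgeCount {n} G = sum (map (λ p → b2n (adj G (Pair.fst p) (Pair.snd p))) (pairs n))

edgesIn : ∀ {n} → Graph n → Triple n → ℕ
edgesIn G (triple a b c) = b2n (adj G a b) + b2n (adj G a c) + b2n (adj G b c)

countK3 : ∀ {n} → Graph n → ℕ
countK3 {n} G = length (filter (λ t → Data.Nat._≟_ (edgesIn G t) 3) (triples n))

countP3 : ∀ {n} → Graph n → ℕ
countP3 {n} G = length (filter (λ t → Data.Nat._≟_ (edgesIn G t) 2) (triples n))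

μ : ∀ {n} → Graph n → ℕ
μ G = 2 Data.Nat.* countK3 G + countP3 G

-- Position (0-based) of the 2-subset {i,j}, i < j (0-based vertices), in the lex
-- order {0,1},{0,2},…,{0,n-1},{1,2},…:  Σ_{a<i} (n-1-a) + (j-i-1).
lexRank : ℕ → ℕ → ℕ → ℕ
lexRank n zero j = j ∸ 1
lexRank n (suc i) j = (n ∸ 1) + lexRank (n ∸ 1) i (j ∸ 1)

lexAdj : (n m : ℕ) → Fin n → Fin n → Bool
lexAdj n m i j =
  if toℕ i <ᵇ toℕ j then lexRank n (toℕ i) (toℕ j) <ᵇ m
  else (if toℕ j <ᵇ toℕ i then lexRank n (toℕ j) (toℕ i) <ᵇ m else false)

n<ᵇn : ∀ k → (k <ᵇ k) ≡ false
n<ᵇn zero = refl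
n<ᵇn (suc k) = n<ᵇn k

≡true⇒T : ∀ {b} → b ≡ true → T b
≡true⇒T refl = tt

lexAdj-sym : ∀ n m i j → lexAdj n m i j ≡ lexAdj n m j i
lexAdj-sym n m i j with toℕ i <ᵇ toℕ j in e1 | toℕ j <ᵇ toℕ i in e2
... | true  | true  = ⊥-elim (<-asym (<ᵇ⇒< (toℕ i) (toℕ j) (≡true⇒T e1)) (<ᵇ⇒< (toℕ j) (toℕ i) (≡true⇒T e2)))
... | true  | false = refl
... | false | true  = refl
... | false | false = refl

lexAdj-irrefl : ∀ n m i → lexAdj n m i i ≡ false
lexAdj-irrefl n m i rewrite n<ᵇn (toℕ i) = refl

L : (n m : ℕ) → Graph n
L n m = record { adj = lexAdj n m ; sym = lexAdj-sym n m ; irrefl = lexAdj-irrefl n m }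

-- A 3-set spanning k edges contributes k ∸ 1 to μ, so μ is a sum of local weights.  Let F(n, m)
-- be μ(L(n, m)), computed by splitting off vertex 0 of the lex graph, which is joined to the first
-- min(m, n − 1) other vertices.  Deleting a vertex v of maximum degree d from G leaves a graph with
-- e edges, and the 3-sets through v weigh at most C(d,2) + e, so by induction
-- μ(G) ≤ F(n − 1, e) + C(d,2) + e.  Since d is at least the average degree 2(d + e)/n, a case
-- analysis comparing e and d + e with n − 1 shows that this is at most F(n, d + e).
module Submission where

open import Defs hiding (sym)
open import Data.Bool using (Bool; true; false; if_then_else_)
open import Data.Bool.Properties using (T-≡)
open import Data.Fin using (Fin; zero; suc; toℕ; punchIn; _<?_)
open import Data.Fin.Properties using (toℕ<n)
open import Data.List using (List; []; _∷_; _++_; map; allFin; filter; length; concatMap; tabulate)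
open import Data.List.Properties using (map-++; map-∘; map-cong)
open import Data.Nat using (ℕ; zero; suc; _+_; _*_; _∸_; _≤_; _<_; _<ᵇ_; _≤ᵇ_; z≤n; s≤s; _≟_; _≤?_)
open import Data.Nat.ListAction using (sum)
open import Data.Nat.ListAction.Properties using (sum-++)
open import Data.Nat.Properties hiding (_<?_)
open import Data.Nat.Tactic.RingSolver using (solve-∀)
open import Algebra.Properties.CommutativeSemigroup +-commutativeSemigroup
  using (interchange; x∙yz≈y∙xz; xy∙z≈xz∙y; xy∙z≈zx∙y; xy∙z≈yz∙x)
open import Data.Product using (Σ-syntax; _,_)
open import Data.Sum using (inj₁; inj₂)
open import Relation.Nullary using (Dec; yes; no; does; contradiction)
open import Relation.Binary.PropositionalEquality
open import Function.Bundles using (Equivalence)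

sumFin : ∀ {n} → (Fin n → ℕ) → ℕ
sumFin {zero}  f = 0
sumFin {suc n} f = f zero + sumFin (λ i → f (suc i))

sumPairs : ∀ {n} → (Fin n → Fin n → ℕ) → ℕ
sumPairs {zero}  g = 0
sumPairs {suc n} g = sumFin (λ b → g zero (suc b)) + sumPairs (λ a b → g (suc a) (suc b))

sumTriples : ∀ {n} → (Fin n → Fin n → Fin n → ℕ) → ℕ
sumTriples {zero}  w = 0
sumTriples {suc n} w =
  sumPairs (λ b c → w zero (suc b) (suc c)) + sumTriples (λ a b c → w (suc a) (suc b) (suc c))

sumFin-cong : ∀ {n} {f g : Fin n → ℕ} → (∀ i → f i ≡ g i) → sumFin f ≡ sumFin g
sumFin-cong {zero}  f≡g = refl
sumFin-cong {suc n} f≡g = cong₂ _+_ (f≡g zero) (sumFin-cong (λ i → f≡g (suc i)))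

sumPairs-cong : ∀ {n} {f g : Fin n → Fin n → ℕ} → (∀ a b → f a b ≡ g a b) → sumPairs f ≡ sumPairs g
sumPairs-cong {zero}  f≡g = refl
sumPairs-cong {suc n} f≡g =
  cong₂ _+_ (sumFin-cong (λ b → f≡g zero (suc b))) (sumPairs-cong (λ a b → f≡g (suc a) (suc b)))

sumTriples-cong : ∀ {n} {f g : Fin n → Fin n → Fin n → ℕ} →
                  (∀ a b c → f a b c ≡ g a b c) → sumTriples f ≡ sumTriples g
sumTriples-cong {zero}  f≡g = refl
sumTriples-cong {suc n} f≡g =
  cong₂ _+_ (sumPairs-cong (λ b c → f≡g zero (suc b) (suc c)))
            (sumTriples-cong (λ a b c → f≡g (suc a) (suc b) (suc c)))

sumFin-mono : ∀ {n} {f g : Fin n → ℕ} → (∀ i → f i ≤ g i) → sumFin f ≤ sumFin g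
sumFin-mono {zero}  f≤g = z≤n
sumFin-mono {suc n} f≤g = +-mono-≤ (f≤g zero) (sumFin-mono (λ i → f≤g (suc i)))

sumPairs-mono : ∀ {n} {f g : Fin n → Fin n → ℕ} → (∀ a b → f a b ≤ g a b) → sumPairs f ≤ sumPairs g
sumPairs-mono {zero}  f≤g = z≤n
sumPairs-mono {suc n} f≤g =
  +-mono-≤ (sumFin-mono (λ b → f≤g zero (suc b))) (sumPairs-mono (λ a b → f≤g (suc a) (suc b)))

sumFin-+ : ∀ {n} (f g : Fin n → ℕ) → sumFin (λ i → f i + g i) ≡ sumFin f + sumFin g
sumFin-+ {zero}  f g = refl
sumFin-+ {suc n} f g = begin
  (f zero + g zero) + sumFin (λ i → f (suc i) + g (suc i))
    ≡⟨ cong ((f zero + g zero) +_) (sumFin-+ (λ i → f (suc i)) (λ i → g (suc i))) ⟩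
  (f zero + g zero) + (sumFin (λ i → f (suc i)) + sumFin (λ i → g (suc i)))
    ≡⟨ interchange (f zero) (g zero) _ _ ⟩
  (f zero + sumFin (λ i → f (suc i))) + (g zero + sumFin (λ i → g (suc i))) ∎
  where open ≡-Reasoning

sumPairs-+ : ∀ {n} (f g : Fin n → Fin n → ℕ) → sumPairs (λ a b → f a b + g a b) ≡ sumPairs f + sumPairs g
sumPairs-+ {zero}  f g = refl
sumPairs-+ {suc n} f g = begin
  sumFin (λ b → f zero (suc b) + g zero (suc b)) + sumPairs (λ a b → f (suc a) (suc b) + g (suc a) (suc b))
    ≡⟨ cong₂ _+_ (sumFin-+ (λ b → f zero (suc b)) (λ b → g zero (suc b)))
                 (sumPairs-+ (λ a b → f (suc a) (suc b)) (λ a b → g (suc a) (suc b))) ⟩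
  (sumFin (λ b → f zero (suc b)) + sumFin (λ b → g zero (suc b)))
    + (sumPairs (λ a b → f (suc a) (suc b)) + sumPairs (λ a b → g (suc a) (suc b)))
    ≡⟨ interchange (sumFin (λ b → f zero (suc b))) _ _ _ ⟩
  sumPairs f + sumPairs g ∎
  where open ≡-Reasoning

sumFin-const : ∀ n c → sumFin {n} (λ _ → c) ≡ n * c
sumFin-const zero    c = refl
sumFin-const (suc n) c = cong (c +_) (sumFin-const n c)

sumFin-≤-* : ∀ {n} {f : Fin n → ℕ} {c} → (∀ i → f i ≤ c) → sumFin f ≤ n * c
sumFin-≤-* {n} {c = c} f≤c = ≤-trans (sumFin-mono f≤c) (≤-reflexive (sumFin-const n c))

choose2 : ℕ → ℕ
choose2 zero    = 0
choose2 (suc k) = k + choose2 k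

sumPairs-const-1 : ∀ n → sumPairs {n} (λ _ _ → 1) ≡ choose2 n
sumPairs-const-1 zero    = refl
sumPairs-const-1 (suc n) = cong₂ _+_ (trans (sumFin-const n 1) (*-identityʳ n)) (sumPairs-const-1 n)

sumFin-punchIn : ∀ {n} (v : Fin (suc n)) (f : Fin (suc n) → ℕ) →
                 sumFin f ≡ f v + sumFin (λ i → f (punchIn v i))
sumFin-punchIn         zero    f = refl
sumFin-punchIn {suc n} (suc v) f = begin
  f zero + sumFin (λ i → f (suc i))
    ≡⟨ cong (f zero +_) (sumFin-punchIn v (λ i → f (suc i))) ⟩
  f zero + (f (suc v) + sumFin (λ i → f (suc (punchIn v i))))
    ≡⟨ x∙yz≈y∙xz (f zero) (f (suc v)) _ ⟩
  f (suc v) + (f zero + sumFin (λ i → f (suc (punchIn v i)))) ∎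
  where open ≡-Reasoning

Symmetric : ∀ {n} → (Fin n → Fin n → ℕ) → Set
Symmetric g = ∀ a b → g a b ≡ g b a

sumPairs-punchIn : ∀ {n} (v : Fin (suc n)) (g : Fin (suc n) → Fin (suc n) → ℕ) → Symmetric g →
  sumPairs g ≡ sumFin (λ i → g v (punchIn v i)) + sumPairs (λ a b → g (punchIn v a) (punchIn v b))
sumPairs-punchIn         zero    g g-sym = refl
sumPairs-punchIn {suc n} (suc v) g g-sym = begin
  sumFin (λ b → g zero (suc b)) + sumPairs (λ a b → g (suc a) (suc b))
    ≡⟨ cong₂ _+_ (sumFin-punchIn v (λ b → g zero (suc b)))
                 (sumPairs-punchIn v (λ a b → g (suc a) (suc b)) (λ a b → g-sym (suc a) (suc b))) ⟩
  (g zero (suc v) + row₀) + (rowᵥ + rest)  ≡⟨ cong (λ x → (x + row₀) + (rowᵥ + rest)) (g-sym zero (suc v)) ⟩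
  (g (suc v) zero + row₀) + (rowᵥ + rest)  ≡⟨ interchange (g (suc v) zero) row₀ rowᵥ rest ⟩
  (g (suc v) zero + rowᵥ) + (row₀ + rest) ∎
  where
  open ≡-Reasoning
  row₀ rowᵥ rest : ℕ
  row₀ = sumFin (λ i → g zero (suc (punchIn v i)))
  rowᵥ = sumFin (λ i → g (suc v) (suc (punchIn v i)))
  rest = sumPairs (λ a b → g (suc (punchIn v a)) (suc (punchIn v b)))

sumTriples-punchIn : ∀ {n} (v : Fin (suc n)) (w : Fin (suc n) → Fin (suc n) → Fin (suc n) → ℕ) →
  (∀ a b c → w a b c ≡ w b a c) → (∀ a b c → w a b c ≡ w a c b) →
  sumTriples w ≡ sumPairs (λ b c → w v (punchIn v b) (punchIn v c))
                 + sumTriples (λ a b c → w (punchIn v a) (punchIn v b) (punchIn v c))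
sumTriples-punchIn         zero    w w-swap₁₂ w-swap₂₃ = refl
sumTriples-punchIn {suc n} (suc v) w w-swap₁₂ w-swap₂₃ = begin
  sumPairs (λ b c → w zero (suc b) (suc c)) + sumTriples (λ a b c → w (suc a) (suc b) (suc c))
    ≡⟨ cong₂ _+_ (sumPairs-punchIn v (λ b c → w zero (suc b) (suc c)) (λ b c → w-swap₂₃ zero (suc b) (suc c)))
                 (sumTriples-punchIn v (λ a b c → w (suc a) (suc b) (suc c))
                   (λ a b c → w-swap₁₂ (suc a) (suc b) (suc c)) (λ a b c → w-swap₂₃ (suc a) (suc b) (suc c))) ⟩
  (sumFin (λ i → w zero (suc v) (suc (punchIn v i))) + pairs₀) + (pairsᵥ + rest)
    ≡⟨ cong (λ x → (x + pairs₀) + (pairsᵥ + rest)) (sumFin-cong (λ i → w-swap₁₂ zero (suc v) (suc (punchIn v i)))) ⟩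
  (sumFin (λ i → w (suc v) zero (suc (punchIn v i))) + pairs₀) + (pairsᵥ + rest)
    ≡⟨ interchange (sumFin (λ i → w (suc v) zero (suc (punchIn v i)))) pairs₀ pairsᵥ rest ⟩
  (sumFin (λ i → w (suc v) zero (suc (punchIn v i))) + pairsᵥ) + (pairs₀ + rest) ∎
  where
  open ≡-Reasoning
  pairs₀ pairsᵥ rest : ℕ
  pairs₀ = sumPairs (λ b c → w zero (suc (punchIn v b)) (suc (punchIn v c)))
  pairsᵥ = sumPairs (λ b c → w (suc v) (suc (punchIn v b)) (suc (punchIn v c)))
  rest   = sumTriples (λ a b c → w (suc (punchIn v a)) (suc (punchIn v b)) (suc (punchIn v c)))

sumPairs-product : ∀ {n} (p : Fin n → Bool) →
                   sumPairs (λ b c → b2n (p b) * b2n (p c)) ≡ choose2 (sumFin (λ b → b2n (p b)))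
sumPairs-product {zero}  p = refl
sumPairs-product {suc n} p with p zero
... | true  = cong₂ _+_ (sumFin-cong (λ b → +-identityʳ (b2n (p (suc b))))) (sumPairs-product (λ b → p (suc b)))
... | false = cong₂ _+_ (trans (sumFin-const n 0) (*-zeroʳ n)) (sumPairs-product (λ b → p (suc b)))

-- Each unordered pair {a,b} occurs twice in the full double sum; the diagonal only adds.
handshake : ∀ {n} (g : Fin n → Fin n → ℕ) → Symmetric g → 2 * sumPairs g ≤ sumFin (λ a → sumFin (g a))
handshake {zero}  g g-sym = z≤n
handshake {suc n} g g-sym = begin
  2 * (X + R)                                                     ≡⟨ double-+ X R ⟩
  X + (X + 2 * R)                                                 ≤⟨ +-monoʳ-≤ X (+-monoʳ-≤ X ih) ⟩
  X + (X + S)                                                     ≡⟨ cong (λ t → X + (t + S)) column≡row ⟩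
  X + (sumFin (λ a → g (suc a) zero) + S)
    ≡⟨ cong (X +_) (sym (sumFin-+ (λ a → g (suc a) zero) (λ a → sumFin (λ b → g (suc a) (suc b))))) ⟩
  X + sumFin (λ a → g (suc a) zero + sumFin (λ b → g (suc a) (suc b)))
    ≤⟨ m≤n+m _ (g zero zero) ⟩
  g zero zero + (X + sumFin (λ a → sumFin (g (suc a))))           ≡⟨ sym (+-assoc (g zero zero) X _) ⟩
  sumFin (λ a → sumFin (g a)) ∎
  where
  open ≤-Reasoning
  X R S : ℕ
  X = sumFin (λ b → g zero (suc b))
  R = sumPairs (λ a b → g (suc a) (suc b))
  S = sumFin (λ a → sumFin (λ b → g (suc a) (suc b)))
  ih : 2 * R ≤ S
  ih = handshake (λ a b → g (suc a) (suc b)) (λ a b → g-sym (suc a) (suc b))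
  column≡row : X ≡ sumFin (λ a → g (suc a) zero)
  column≡row = sumFin-cong (λ a → g-sym zero (suc a))
  double-+ : ∀ x r → 2 * (x + r) ≡ x + (x + 2 * r)
  double-+ = solve-∀

argmax : ∀ {n} (f : Fin (suc n) → ℕ) → Σ[ v ∈ Fin (suc n) ] (∀ i → f i ≤ f v)
argmax {zero} f = zero , λ { zero → ≤-refl }
argmax {suc n} f with argmax (λ i → f (suc i))
... | v , max with f zero ≤? f (suc v)
...   | yes f0≤fv = suc v , λ { zero → f0≤fv ; (suc i) → max i }
...   | no  f0≰fv = zero , λ { zero → ≤-refl ; (suc i) → ≤-trans (max i) (<⇒≤ (≰⇒> f0≰fv)) }

sum-map-++ : ∀ {A : Set} (h : A → ℕ) (xs ys : List A) → sum (map h (xs ++ ys)) ≡ sum (map h xs) + sum (map h ys)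
sum-map-++ h xs ys = trans (cong sum (map-++ h xs ys)) (sum-++ (map h xs) (map h ys))

sum-map-concatMap : ∀ {A B : Set} (h : B → ℕ) (k : A → List B) (xs : List A) →
                    sum (map h (concatMap k xs)) ≡ sum (map (λ x → sum (map h (k x))) xs)
sum-map-concatMap h k []       = refl
sum-map-concatMap h k (x ∷ xs) =
  trans (sum-map-++ h (k x) (concatMap k xs)) (cong (sum (map h (k x)) +_) (sum-map-concatMap h k xs))

sum-map-filter : ∀ {A : Set} {P : A → Set} (P? : ∀ x → Dec (P x)) (h : A → ℕ) (xs : List A) →
                 sum (map h (filter P? xs)) ≡ sum (map (λ x → if does (P? x) then h x else 0) xs)
sum-map-filter P? h []       = refl
sum-map-filter P? h (x ∷ xs) with does (P? x)
... | true  = cong (h x +_) (sum-map-filter P? h xs)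
... | false = sum-map-filter P? h xs

length-filter : ∀ {A : Set} {P : A → Set} (P? : ∀ x → Dec (P x)) (xs : List A) →
                length (filter P? xs) ≡ sum (map (λ x → b2n (does (P? x))) xs)
length-filter P? []       = refl
length-filter P? (x ∷ xs) with does (P? x)
... | true  = cong suc (length-filter P? xs)
... | false = length-filter P? xs

sum-map-tabulate : ∀ {A : Set} {n} (h : A → ℕ) (f : Fin n → A) → sum (map h (tabulate f)) ≡ sumFin (λ i → h (f i))
sum-map-tabulate {n = zero}  h f = refl
sum-map-tabulate {n = suc n} h f = cong (h (f zero) +_) (sum-map-tabulate h (λ i → f (suc i)))

sum-map-allFin : ∀ {n} (h : Fin n → ℕ) → sum (map h (allFin n)) ≡ sumFin h
sum-map-allFin h = sum-map-tabulate h (λ i → i)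

sum-map-above : ∀ {A : Set} {n} (h : A → ℕ) (f : Fin n → A) (i : Fin n) →
                sum (map h (map f (filter (i <?_) (allFin n))))
                ≡ sumFin (λ j → if toℕ i <ᵇ toℕ j then h (f j) else 0)
sum-map-above {n = n} h f i = begin
  sum (map h (map f (filter (i <?_) (allFin n))))      ≡⟨ cong sum (sym (map-∘ (filter (i <?_) (allFin n)))) ⟩
  sum (map (λ j → h (f j)) (filter (i <?_) (allFin n)))  ≡⟨ sum-map-filter (i <?_) (λ j → h (f j)) (allFin n) ⟩
  sum (map above (allFin n))                             ≡⟨ sum-map-allFin above ⟩
  sumFin above ∎
  where
  open ≡-Reasoning
  above : Fin n → ℕ
  above j = if toℕ i <ᵇ toℕ j then h (f j) else 0

sumFin-above≡sumPairs : ∀ {n} (g : Fin n → Fin n → ℕ) →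
                        sumFin (λ i → sumFin (λ j → if toℕ i <ᵇ toℕ j then g i j else 0)) ≡ sumPairs g
sumFin-above≡sumPairs {zero}  g = refl
sumFin-above≡sumPairs {suc n} g =
  cong (sumFin (λ j → g zero (suc j)) +_) (sumFin-above≡sumPairs (λ a b → g (suc a) (suc b)))

sumPairs-above≡sumTriples : ∀ {n} (w : Fin n → Fin n → Fin n → ℕ) →
  sumPairs (λ a b → sumFin (λ k → if toℕ b <ᵇ toℕ k then w a b k else 0)) ≡ sumTriples w
sumPairs-above≡sumTriples {zero}  w = refl
sumPairs-above≡sumTriples {suc n} w =
  cong₂ _+_ (sumFin-above≡sumPairs (λ b c → w zero (suc b) (suc c)))
            (sumPairs-above≡sumTriples (λ a b c → w (suc a) (suc b) (suc c)))

sum-map-pairs : ∀ {n} (h : Pair n → ℕ) → sum (map h (pairs n)) ≡ sumPairs (λ a b → h (pair a b))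
sum-map-pairs {n} h = begin
  sum (map h (pairs n))
    ≡⟨ sum-map-concatMap h _ (allFin n) ⟩
  sum (map (λ i → sum (map h (map (pair i) (filter (i <?_) (allFin n))))) (allFin n))
    ≡⟨ sum-map-allFin (λ i → sum (map h (map (pair i) (filter (i <?_) (allFin n))))) ⟩
  sumFin (λ i → sum (map h (map (pair i) (filter (i <?_) (allFin n)))))
    ≡⟨ sumFin-cong (λ i → sum-map-above h (pair i) i) ⟩
  sumFin (λ i → sumFin (λ j → if toℕ i <ᵇ toℕ j then h (pair i j) else 0))
    ≡⟨ sumFin-above≡sumPairs (λ a b → h (pair a b)) ⟩
  sumPairs (λ a b → h (pair a b)) ∎
  where open ≡-Reasoning

sum-map-triples : ∀ {n} (h : Triple n → ℕ) → sum (map h (triples n)) ≡ sumTriples (λ a b c → h (triple a b c))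
sum-map-triples {n} h = begin
  sum (map h (triples n))
    ≡⟨ sum-map-concatMap h _ (pairs n) ⟩
  sum (map above (pairs n))
    ≡⟨ sum-map-pairs above ⟩
  sumPairs (λ a b → sum (map h (map (triple a b) (filter (b <?_) (allFin n)))))
    ≡⟨ sumPairs-cong (λ a b → sum-map-above h (triple a b) b) ⟩
  sumPairs (λ a b → sumFin (λ k → if toℕ b <ᵇ toℕ k then h (triple a b k) else 0))
    ≡⟨ sumPairs-above≡sumTriples (λ a b c → h (triple a b c)) ⟩
  sumTriples (λ a b c → h (triple a b c)) ∎
  where
  open ≡-Reasoning
  above : Pair n → ℕ
  above p = sum (map h (map (triple (Pair.fst p) (Pair.snd p)) (filter (Pair.snd p <?_) (allFin n))))

sum-map-2*-+ : ∀ {A : Set} (f g : A → ℕ) (xs : List A) →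
               2 * sum (map f xs) + sum (map g xs) ≡ sum (map (λ x → 2 * f x + g x) xs)
sum-map-2*-+ f g []       = refl
sum-map-2*-+ f g (x ∷ xs) = begin
  2 * (f x + sum (map f xs)) + (g x + sum (map g xs))  ≡⟨ regroup (f x) (g x) (sum (map f xs)) (sum (map g xs)) ⟩
  (2 * f x + g x) + (2 * sum (map f xs) + sum (map g xs))  ≡⟨ cong ((2 * f x + g x) +_) (sum-map-2*-+ f g xs) ⟩
  (2 * f x + g x) + sum (map (λ x → 2 * f x + g x) xs) ∎
  where
  open ≡-Reasoning
  regroup : ∀ a b c d → 2 * (a + c) + (b + d) ≡ (2 * a + b) + (2 * c + d)
  regroup = solve-∀

edge : ∀ {n} → Graph n → Fin n → Fin n → ℕ
edge G a b = b2n (adj G a b)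

edgeSum : ∀ {n} → Graph n → ℕ
edgeSum G = sumPairs (edge G)

-- A triangle has 3 edges and weight 2, an induced P₃ has 2 edges and weight 1.
triWeight : ∀ {n} → Graph n → Fin n → Fin n → Fin n → ℕ
triWeight G a b c = edgesIn G (triple a b c) ∸ 1

weightSum : ∀ {n} → Graph n → ℕ
weightSum G = sumTriples (triWeight G)

edge-sym : ∀ {n} (G : Graph n) → Symmetric (edge G)
edge-sym G a b = cong b2n (Graph.sym G a b)

triWeight-swap₁₂ : ∀ {n} (G : Graph n) a b c → triWeight G a b c ≡ triWeight G b a c
triWeight-swap₁₂ G a b c = cong (_∸ 1) (trans
  (cong (λ t → t + edge G a c + edge G b c) (edge-sym G a b))
  (xy∙z≈xz∙y (edge G b a) (edge G a c) (edge G b c)))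

triWeight-swap₂₃ : ∀ {n} (G : Graph n) a b c → triWeight G a b c ≡ triWeight G a c b
triWeight-swap₂₃ G a b c =
  cong (_∸ 1) (cong₂ _+_ (+-comm (edge G a b) (edge G a c)) (edge-sym G b c))

indicators≡edges∸1 : ∀ x y z → let k = b2n x + b2n y + b2n z in
                     2 * b2n (does (k ≟ 3)) + b2n (does (k ≟ 2)) ≡ k ∸ 1
indicators≡edges∸1 true  true  true  = refl
indicators≡edges∸1 true  true  false = refl
indicators≡edges∸1 true  false true  = refl
indicators≡edges∸1 true  false false = refl
indicators≡edges∸1 false true  true  = refl
indicators≡edges∸1 false true  false = refl
indicators≡edges∸1 false false true  = refl
indicators≡edges∸1 false false false = refl

μ≡weightSum : ∀ {n} (G : Graph n) → μ G ≡ weightSum G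
μ≡weightSum {n} G = begin
  2 * length (filter (λ t → edgesIn G t ≟ 3) (triples n)) + length (filter (λ t → edgesIn G t ≟ 2) (triples n))
    ≡⟨ cong₂ (λ x y → 2 * x + y) (length-filter (λ t → edgesIn G t ≟ 3) (triples n))
                                  (length-filter (λ t → edgesIn G t ≟ 2) (triples n)) ⟩
  2 * sum (map (indicator 3) (triples n)) + sum (map (indicator 2) (triples n))
    ≡⟨ sum-map-2*-+ (indicator 3) (indicator 2) (triples n) ⟩
  sum (map (λ t → 2 * indicator 3 t + indicator 2 t) (triples n))
    ≡⟨ cong sum (map-cong (λ { (triple a b c) → indicators≡edges∸1 (adj G a b) (adj G a c) (adj G b c) }) (triples n)) ⟩
  sum (map (λ t → edgesIn G t ∸ 1) (triples n))
    ≡⟨ sum-map-triples (λ t → edgesIn G t ∸ 1) ⟩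
  weightSum G ∎
  where
  open ≡-Reasoning
  indicator : ℕ → Triple n → ℕ
  indicator k t = b2n (does (edgesIn G t ≟ k))

edgeCount≡edgeSum : ∀ {n} (G : Graph n) → edgeCount G ≡ edgeSum G
edgeCount≡edgeSum G = sum-map-pairs (λ p → edge G (Pair.fst p) (Pair.snd p))

b2n≤1 : ∀ b → b2n b ≤ 1
b2n≤1 true  = ≤-refl
b2n≤1 false = z≤n

edgeSum≤choose2 : ∀ {n} (G : Graph n) → edgeSum G ≤ choose2 n
edgeSum≤choose2 {n} G = subst (edgeSum G ≤_) (sumPairs-const-1 n) (sumPairs-mono (λ a b → b2n≤1 (adj G a b)))

edgeSum-cong : ∀ {n} {G H : Graph n} → (∀ a b → adj G a b ≡ adj H a b) → edgeSum G ≡ edgeSum H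
edgeSum-cong G≡H = sumPairs-cong (λ a b → cong b2n (G≡H a b))

edges∸1-cong : ∀ {p q r p′ q′ r′} → p ≡ p′ → q ≡ q′ → r ≡ r′ →
              (b2n p + b2n q + b2n r) ∸ 1 ≡ (b2n p′ + b2n q′ + b2n r′) ∸ 1
edges∸1-cong refl refl refl = refl

weightSum-cong : ∀ {n} {G H : Graph n} → (∀ a b → adj G a b ≡ adj H a b) → weightSum G ≡ weightSum H
weightSum-cong G≡H = sumTriples-cong (λ a b c → edges∸1-cong (G≡H a b) (G≡H a c) (G≡H b c))

removeVertex : ∀ {n} → Graph (suc n) → Fin (suc n) → Graph n
removeVertex G v = record
  { adj    = λ a b → adj G (punchIn v a) (punchIn v b)
  ; sym    = λ a b → Graph.sym G (punchIn v a) (punchIn v b)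
  ; irrefl = λ a → irrefl G (punchIn v a)
  }

degree : ∀ {n} → Graph (suc n) → Fin (suc n) → ℕ
degree G v = sumFin (λ i → edge G v (punchIn v i))

weightAt : ∀ {n} → Graph (suc n) → Fin (suc n) → ℕ
weightAt G v = sumPairs (λ b c → triWeight G v (punchIn v b) (punchIn v c))

edgeSum-removeVertex : ∀ {n} (G : Graph (suc n)) v → edgeSum G ≡ degree G v + edgeSum (removeVertex G v)
edgeSum-removeVertex G v = sumPairs-punchIn v (edge G) (edge-sym G)

weightSum-removeVertex : ∀ {n} (G : Graph (suc n)) v → weightSum G ≡ weightAt G v + weightSum (removeVertex G v)
weightSum-removeVertex G v = sumTriples-punchIn v (triWeight G) (triWeight-swap₁₂ G) (triWeight-swap₂₃ G)

degree≤ : ∀ {n} (G : Graph (suc n)) v → degree G v ≤ n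
degree≤ {n} G v = subst (degree G v ≤_) (*-identityʳ n) (sumFin-≤-* (λ i → b2n≤1 (adj G v (punchIn v i))))

edges∸1≤cherry+edge : ∀ x y z → (b2n x + b2n y + b2n z) ∸ 1 ≤ b2n x * b2n y + b2n z
edges∸1≤cherry+edge true  true  z = ≤-refl
edges∸1≤cherry+edge true  false z = ≤-refl
edges∸1≤cherry+edge false true  z = ≤-refl
edges∸1≤cherry+edge false false z = m∸n≤m (b2n z) 1

weightAt≤ : ∀ {n} (G : Graph (suc n)) v → weightAt G v ≤ choose2 (degree G v) + edgeSum (removeVertex G v)
weightAt≤ {n} G v = begin
  weightAt G v
    ≤⟨ sumPairs-mono (λ b c → edges∸1≤cherry+edge (adj G v (punchIn v b)) (adj G v (punchIn v c)) _) ⟩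
  sumPairs (λ b c → cherry b c + edge (removeVertex G v) b c)
    ≡⟨ sumPairs-+ cherry (edge (removeVertex G v)) ⟩
  sumPairs cherry + edgeSum (removeVertex G v)
    ≡⟨ cong (_+ edgeSum (removeVertex G v)) (sumPairs-product (λ b → adj G v (punchIn v b))) ⟩
  choose2 (degree G v) + edgeSum (removeVertex G v) ∎
  where
  open ≤-Reasoning
  cherry : Fin n → Fin n → ℕ
  cherry b c = edge G v (punchIn v b) * edge G v (punchIn v c)

-- d is at least the average degree of a graph with suc n vertices and d + e edges
AboveAverage : ℕ → ℕ → ℕ → Set
AboveAverage n d e = 2 * (d + e) ≤ suc n * d

maxDegreeVertex : ∀ {n} (G : Graph (suc n)) →
                  Σ[ v ∈ Fin (suc n) ] AboveAverage n (degree G v) (edgeSum (removeVertex G v))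
maxDegreeVertex {n} G with argmax (λ a → sumFin (edge G a))
... | v , max = v , (begin
  2 * (degree G v + edgeSum (removeVertex G v))  ≡⟨ cong (2 *_) (sym (edgeSum-removeVertex G v)) ⟩
  2 * edgeSum G                                  ≤⟨ handshake (edge G) (edge-sym G) ⟩
  sumFin (λ a → sumFin (edge G a))               ≤⟨ sumFin-≤-* max ⟩
  suc n * sumFin (edge G v)                      ≡⟨ cong (suc n *_) row≡degree ⟩
  suc n * degree G v ∎)
  where
  open ≤-Reasoning
  row≡degree : sumFin (edge G v) ≡ degree G v
  row≡degree = trans (sumFin-punchIn v (edge G v)) (cong (λ b → b2n b + degree G v) (irrefl G v))

choose2-+ : ∀ a b → choose2 (a + b) ≡ choose2 a + choose2 b + a * b
choose2-+ zero    b = sym (+-identityʳ (choose2 b))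
choose2-+ (suc a) b = begin
  (a + b) + choose2 (a + b)                        ≡⟨ cong ((a + b) +_) (choose2-+ a b) ⟩
  (a + b) + (choose2 a + choose2 b + a * b)        ≡⟨ regroup a b (choose2 a) (choose2 b) (a * b) ⟩
  (a + choose2 a) + choose2 b + (b + a * b) ∎
  where
  open ≡-Reasoning
  regroup : ∀ a b A B P → a + b + (A + B + P) ≡ a + A + B + (b + P)
  regroup = solve-∀

-- lexBound n m is μ (L n m) for m ≤ choose2 n.  In L (suc n) m with n ≤ m, vertex 0 is adjacent to
-- all others, which gives choose2 n cherries at 0 and one more 3-set for each of the m ∸ n edges
-- among the rest; otherwise L (suc n) m is a star with m edges.
lexBound : ℕ → ℕ → ℕ
lexBound zero    m = 0
lexBound (suc n) m = if n ≤ᵇ m then lexBound n (m ∸ n) + choose2 n + (m ∸ n) else choose2 m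

lexBound-suc-+ : ∀ n x → lexBound (suc n) (n + x) ≡ lexBound n x + choose2 n + x
lexBound-suc-+ n x rewrite Equivalence.to T-≡ (≤⇒≤ᵇ (m≤m+n n x)) | m+n∸m≡n n x = refl

lexBound-suc-< : ∀ {n m} → m < n → lexBound (suc n) m ≡ choose2 m
lexBound-suc-< {n} {m} m<n with n ≤ᵇ m in n≤ᵇm
... | false = refl
... | true  = contradiction (≤ᵇ⇒≤ n m (Equivalence.from T-≡ n≤ᵇm)) (<⇒≱ m<n)

lexBound-zeroʳ : ∀ n → lexBound n 0 ≡ 0
lexBound-zeroʳ zero          = refl
lexBound-zeroʳ (suc zero)    = refl
lexBound-zeroʳ (suc (suc n)) = refl

lexBound-suc-≤ : ∀ {n m} → m ≤ n → lexBound (suc n) m ≡ choose2 m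
lexBound-suc-≤ {m = m} m≤n with m≤n⇒m<n∨m≡n m≤n
... | inj₁ m<n  = lexBound-suc-< m<n
... | inj₂ refl = begin
  lexBound (suc m) m            ≡⟨ cong (lexBound (suc m)) (sym (+-identityʳ m)) ⟩
  lexBound (suc m) (m + 0)      ≡⟨ lexBound-suc-+ m 0 ⟩
  lexBound m 0 + choose2 m + 0  ≡⟨ cong (λ t → t + choose2 m + 0) (lexBound-zeroʳ m) ⟩
  choose2 m + 0                 ≡⟨ +-identityʳ (choose2 m) ⟩
  choose2 m ∎
  where open ≡-Reasoning

aboveAverage-isolated : ∀ {n e} → AboveAverage n 0 e → e ≡ 0
aboveAverage-isolated {n} {zero}  avg = refl
aboveAverage-isolated {n} {suc e} avg with subst (2 * suc e ≤_) (*-zeroʳ (suc n)) avg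
... | ()

aboveAverage-shift : ∀ {n d} y → d ≤ n → AboveAverage (suc n) (suc d) (n + y) → AboveAverage n d y
aboveAverage-shift {n} {d} y d≤n avg = begin
  2 * (d + y)      ≡⟨ double d y ⟩
  d + (d + 2 * y)  ≤⟨ +-monoʳ-≤ d (+-monoˡ-≤ (2 * y) d≤n) ⟩
  d + (n + 2 * y)  ≤⟨ +-monoʳ-≤ d (+-cancelˡ-≤ (2 + 2 * d + n) _ _ (subst₂ _≤_ (lhs n d y) (rhs n d) avg)) ⟩
  d + n * d        ≡⟨⟩
  suc n * d ∎
  where
  open ≤-Reasoning
  double : ∀ d y → 2 * (d + y) ≡ d + (d + 2 * y)
  double = solve-∀
  lhs : ∀ n d y → 2 * (suc d + (n + y)) ≡ (2 + 2 * d + n) + (n + 2 * y)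
  lhs = solve-∀
  rhs : ∀ n d → suc (suc n) * suc d ≡ (2 + 2 * d + n) + n * d
  rhs = solve-∀

lexBound-addVertex-sparse : ∀ {n} d e → d + e < n →
  lexBound (suc n) e + choose2 (suc d) + e ≤ lexBound (suc (suc n)) (suc d + e)
lexBound-addVertex-sparse {n} d e d+e<n = begin
  lexBound (suc n) e + choose2 (suc d) + e  ≡⟨ cong (λ t → t + choose2 (suc d) + e) (lexBound-suc-≤ e≤n) ⟩
  choose2 e + choose2 (suc d) + e           ≡⟨ cong (_+ e) (+-comm (choose2 e) (choose2 (suc d))) ⟩
  choose2 (suc d) + choose2 e + e           ≤⟨ +-monoʳ-≤ (choose2 (suc d) + choose2 e) (m≤m+n e (d * e)) ⟩
  choose2 (suc d) + choose2 e + suc d * e   ≡⟨ sym (choose2-+ (suc d) e) ⟩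
  choose2 (suc d + e)                       ≡⟨ sym (lexBound-suc-< (s≤s d+e<n)) ⟩
  lexBound (suc (suc n)) (suc d + e) ∎
  where
  open ≤-Reasoning
  e≤n : e ≤ n
  e≤n = ≤-trans (m≤n+m e d) (<⇒≤ d+e<n)

-- Write n = d + Y and e = Y + x; the inequality reduces to Y * (suc x) ≤ Y * (suc d).
lexBound-addVertex-medium : ∀ {n} d e → d ≤ n → e < n → n ≤ d + e →
  lexBound (suc n) e + choose2 (suc d) + e ≤ lexBound (suc (suc n)) (suc d + e)
lexBound-addVertex-medium d e d≤n e<n n≤d+e with m≤n⇒∃[o]m+o≡n d≤n
... | Y , refl with m≤n⇒∃[o]m+o≡n (+-cancelˡ-≤ d Y e n≤d+e)
...   | x , refl = begin
  lexBound (suc (d + Y)) (Y + x) + choose2 (suc d) + (Y + x)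
    ≡⟨ cong (λ t → t + choose2 (suc d) + (Y + x)) (trans (lexBound-suc-≤ (<⇒≤ e<n)) (choose2-+ Y x)) ⟩
  choose2 Y + choose2 x + Y * x + choose2 (suc d) + (Y + x)
    ≡⟨ regroup (choose2 Y) (choose2 x) Y x (choose2 (suc d)) ⟩
  choose2 x + (choose2 (suc d) + choose2 Y) + x + suc x * Y
    ≤⟨ +-monoʳ-≤ (choose2 x + (choose2 (suc d) + choose2 Y) + x) (*-monoˡ-≤ Y (s≤s x≤d)) ⟩
  choose2 x + (choose2 (suc d) + choose2 Y) + x + suc d * Y
    ≡⟨ regroup′ (choose2 x) (choose2 (suc d) + choose2 Y) x (suc d * Y) ⟩
  choose2 x + (choose2 (suc d) + choose2 Y + suc d * Y) + x
    ≡⟨ cong (λ t → choose2 x + t + x) (sym (choose2-+ (suc d) Y)) ⟩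
  choose2 x + choose2 (suc d + Y) + x
    ≡⟨ cong (λ t → t + choose2 (suc d + Y) + x) (sym (lexBound-suc-≤ (≤-trans x≤d (m≤m+n d Y)))) ⟩
  lexBound (suc (d + Y)) x + choose2 (suc (d + Y)) + x
    ≡⟨ sym (lexBound-suc-+ (suc (d + Y)) x) ⟩
  lexBound (suc (suc (d + Y))) (suc (d + Y) + x)
    ≡⟨ cong (λ t → lexBound (suc (suc (d + Y))) (suc t)) (+-assoc d Y x) ⟩
  lexBound (suc (suc (d + Y))) (suc d + (Y + x)) ∎
  where
  open ≤-Reasoning
  x≤d : x ≤ d
  x≤d = <⇒≤ (+-cancelˡ-< Y x d (subst (Y + x <_) (+-comm d Y) e<n))
  regroup : ∀ cY cx Y x cd → cY + cx + Y * x + cd + (Y + x) ≡ cx + (cd + cY) + x + (Y + x * Y)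
  regroup = solve-∀
  regroup′ : ∀ a b c d → a + b + c + d ≡ a + (b + d) + c
  regroup′ = solve-∀

lexBound-addVertex : ∀ n d e → d ≤ n → AboveAverage n d e →
                     lexBound n e + choose2 d + e ≤ lexBound (suc n) (d + e)
lexBound-addVertex n d e d≤n avg with m≤n⇒m<n∨m≡n d≤n
... | inj₂ refl = ≤-reflexive (sym (lexBound-suc-+ d e))
lexBound-addVertex (suc n) zero e _ avg | inj₁ _ with aboveAverage-isolated {suc n} {e} avg
... | refl rewrite lexBound-zeroʳ (suc n) = z≤n
lexBound-addVertex (suc n) (suc d) e _ avg | inj₁ (s≤s d<n) with n ≤? e | n ≤? d + e
... | no n≰e | no n≰d+e  = lexBound-addVertex-sparse d e (≰⇒> n≰d+e)
... | no n≰e | yes n≤d+e = lexBound-addVertex-medium d e (<⇒≤ d<n) (≰⇒> n≰e) n≤d+e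
... | yes n≤e | _ with m≤n⇒∃[o]m+o≡n n≤e
...   | y , refl = begin
  lexBound (suc n) (n + y) + choose2 (suc d) + (n + y)
    ≡⟨ cong (λ t → t + choose2 (suc d) + (n + y)) (lexBound-suc-+ n y) ⟩
  lexBound n y + choose2 n + y + (d + choose2 d) + (n + y)
    ≡⟨ regroup (lexBound n y) (choose2 n) y d (choose2 d) n ⟩
  (lexBound n y + choose2 d + y) + (n + choose2 n) + (d + y)
    ≤⟨ +-monoˡ-≤ (d + y) (+-monoˡ-≤ (n + choose2 n) ih) ⟩
  lexBound (suc n) (d + y) + choose2 (suc n) + (d + y)
    ≡⟨ sym (lexBound-suc-+ (suc n) (d + y)) ⟩
  lexBound (suc (suc n)) (suc n + (d + y))
    ≡⟨ cong (λ t → lexBound (suc (suc n)) (suc t)) (x∙yz≈y∙xz n d y) ⟩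
  lexBound (suc (suc n)) (suc d + (n + y)) ∎
  where
  open ≤-Reasoning
  ih : lexBound n y + choose2 d + y ≤ lexBound (suc n) (d + y)
  ih = lexBound-addVertex n d y (<⇒≤ d<n) (aboveAverage-shift y (<⇒≤ d<n) avg)
  regroup : ∀ F c y d C n → F + c + y + (d + C) + (n + y) ≡ (F + C + y) + (n + c) + (d + y)
  regroup = solve-∀

+-<ᵇ-∸ : ∀ n r m → (n + r <ᵇ m) ≡ (r <ᵇ m ∸ n)
+-<ᵇ-∸ zero    r m       = refl
+-<ᵇ-∸ (suc n) r zero    = refl
+-<ᵇ-∸ (suc n) r (suc m) = +-<ᵇ-∸ n r m

lexAdj-suc : ∀ n m (i j : Fin n) → lexAdj (suc n) m (suc i) (suc j) ≡ lexAdj n (m ∸ n) i j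
lexAdj-suc n m i j with toℕ i <ᵇ toℕ j | toℕ j <ᵇ toℕ i
... | true  | _     = +-<ᵇ-∸ n (lexRank n (toℕ i) (toℕ j)) m
... | false | true  = +-<ᵇ-∸ n (lexRank n (toℕ j) (toℕ i)) m
... | false | false = refl

lexAdj-empty : ∀ n (i j : Fin n) → lexAdj n 0 i j ≡ false
lexAdj-empty n i j with toℕ i <ᵇ toℕ j | toℕ j <ᵇ toℕ i
... | true  | _     = refl
... | false | true  = refl
... | false | false = refl

-- vertex 0 of L (suc n) m is adjacent to suc i exactly when toℕ i < m
neighbours-L-zero : ∀ n m → Fin n → ℕ
neighbours-L-zero n m i = b2n (toℕ i <ᵇ m)

sumFin-neighbours-L-zero : ∀ {n m} → m ≤ n → sumFin (neighbours-L-zero n m) ≡ m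
sumFin-neighbours-L-zero {zero}  {zero}  z≤n       = refl
sumFin-neighbours-L-zero {suc n} {zero}  z≤n       = trans (sumFin-const n 0) (*-zeroʳ n)
sumFin-neighbours-L-zero {suc n} {suc m} (s≤s m≤n) = cong suc (sumFin-neighbours-L-zero m≤n)

neighbours-L-zero-full : ∀ n x (i : Fin n) → (toℕ i <ᵇ n + x) ≡ true
neighbours-L-zero-full n x i = Equivalence.to T-≡ (<⇒<ᵇ (≤-trans (toℕ<n i) (m≤m+n n x)))

sumFin-neighbours-L-zero-full : ∀ n x → sumFin (neighbours-L-zero n (n + x)) ≡ n
sumFin-neighbours-L-zero-full n x =
  trans (sumFin-cong (λ i → cong b2n (neighbours-L-zero-full n x i))) (trans (sumFin-const n 1) (*-identityʳ n))

edgeSum-L-suc : ∀ n m → edgeSum (L (suc n) m) ≡ sumFin (neighbours-L-zero n m) + edgeSum (L n (m ∸ n))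
edgeSum-L-suc n m =
  cong (sumFin (neighbours-L-zero n m) +_)
       (edgeSum-cong {G = removeVertex (L (suc n) m) zero} {H = L n (m ∸ n)} (lexAdj-suc n m))

weightSum-L-suc : ∀ n m → weightSum (L (suc n) m) ≡ weightAt (L (suc n) m) zero + weightSum (L n (m ∸ n))
weightSum-L-suc n m =
  cong (weightAt (L (suc n) m) zero +_)
       (weightSum-cong {G = removeVertex (L (suc n) m) zero} {H = L n (m ∸ n)} (lexAdj-suc n m))

edge-L-suc : ∀ n x (b c : Fin n) → lexAdj (suc n) (n + x) (suc b) (suc c) ≡ adj (L n x) b c
edge-L-suc n x b c = trans (lexAdj-suc n (n + x) b c) (cong (λ t → lexAdj n t b c) (m+n∸m≡n n x))

weightAt-L-full : ∀ n x → weightAt (L (suc n) (n + x)) zero ≡ choose2 n + edgeSum (L n x)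
weightAt-L-full n x = begin
  weightAt (L (suc n) (n + x)) zero
    ≡⟨ sumPairs-cong (λ b c → edges∸1-cong (neighbours-L-zero-full n x b) (neighbours-L-zero-full n x c)
                                           (edge-L-suc n x b c)) ⟩
  sumPairs (λ b c → 1 + edge (L n x) b c)  ≡⟨ sumPairs-+ {n} (λ _ _ → 1) (edge (L n x)) ⟩
  sumPairs {n} (λ _ _ → 1) + edgeSum (L n x)   ≡⟨ cong (_+ edgeSum (L n x)) (sumPairs-const-1 n) ⟩
  choose2 n + edgeSum (L n x) ∎
  where open ≡-Reasoning

edges∸1-star : ∀ p q → (b2n p + b2n q + 0) ∸ 1 ≡ b2n p * b2n q
edges∸1-star true  true  = refl
edges∸1-star true  false = refl
edges∸1-star false true  = refl
edges∸1-star false false = refl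

weightAt-L-star : ∀ {n m} → m < n → weightAt (L (suc n) m) zero ≡ choose2 m
weightAt-L-star {n} {m} m<n = begin
  weightAt (L (suc n) m) zero
    ≡⟨ sumPairs-cong {n} (λ b c → edges∸1-cong {toℕ b <ᵇ m} {toℕ c <ᵇ m} refl refl (no-edge b c)) ⟩
  sumPairs (λ b c → (neighbours-L-zero n m b + neighbours-L-zero n m c + 0) ∸ 1)
    ≡⟨ sumPairs-cong {n} (λ b c → edges∸1-star (toℕ b <ᵇ m) (toℕ c <ᵇ m)) ⟩
  sumPairs (λ b c → neighbours-L-zero n m b * neighbours-L-zero n m c)
    ≡⟨ sumPairs-product {n} (λ b → toℕ b <ᵇ m) ⟩
  choose2 (sumFin (neighbours-L-zero n m))
    ≡⟨ cong choose2 (sumFin-neighbours-L-zero (<⇒≤ m<n)) ⟩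
  choose2 m ∎
  where
  open ≡-Reasoning
  no-edge : ∀ b c → lexAdj (suc n) m (suc b) (suc c) ≡ false
  no-edge b c = trans (lexAdj-suc n m b c)
                      (trans (cong (λ t → lexAdj n t b c) (m≤n⇒m∸n≡0 (<⇒≤ m<n))) (lexAdj-empty n b c))

edgeSum-L-≥ : ∀ n m → m ≤ choose2 n → m ≤ edgeSum (L n m)
edgeSum-L-≥ zero    m m≤0 = m≤0
edgeSum-L-≥ (suc n) m m≤choose2 with n ≤? m
... | no n≰m = begin
  m                                                       ≡⟨ sym (sumFin-neighbours-L-zero (<⇒≤ (≰⇒> n≰m))) ⟩
  sumFin (neighbours-L-zero n m)                          ≤⟨ m≤m+n _ _ ⟩
  sumFin (neighbours-L-zero n m) + edgeSum (L n (m ∸ n))  ≡⟨ sym (edgeSum-L-suc n m) ⟩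
  edgeSum (L (suc n) m) ∎
  where open ≤-Reasoning
... | yes n≤m with m≤n⇒∃[o]m+o≡n n≤m
...   | x , refl = begin
  n + x                ≤⟨ +-monoʳ-≤ n (edgeSum-L-≥ n x (+-cancelˡ-≤ n x (choose2 n) m≤choose2)) ⟩
  n + edgeSum (L n x)  ≡⟨ cong₂ _+_ (sym (sumFin-neighbours-L-zero-full n x))
                                   (cong (λ t → edgeSum (L n t)) (sym (m+n∸m≡n n x))) ⟩
  sumFin (neighbours-L-zero n (n + x)) + edgeSum (L n (n + x ∸ n))  ≡⟨ sym (edgeSum-L-suc n (n + x)) ⟩
  edgeSum (L (suc n) (n + x)) ∎
  where open ≤-Reasoning

lexBound≤weightSum-L : ∀ n m → m ≤ choose2 n → lexBound n m ≤ weightSum (L n m)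
lexBound≤weightSum-L zero    m _ = z≤n
lexBound≤weightSum-L (suc n) m m≤choose2 with n ≤? m
... | no n≰m = begin
  lexBound (suc n) m                                                ≡⟨ lexBound-suc-< m<n ⟩
  choose2 m                                                         ≡⟨ sym (weightAt-L-star m<n) ⟩
  weightAt (L (suc n) m) zero                                       ≤⟨ m≤m+n _ _ ⟩
  weightAt (L (suc n) m) zero + weightSum (L n (m ∸ n))             ≡⟨ sym (weightSum-L-suc n m) ⟩
  weightSum (L (suc n) m) ∎
  where
  open ≤-Reasoning
  m<n : m < n
  m<n = ≰⇒> n≰m
... | yes n≤m with m≤n⇒∃[o]m+o≡n n≤m
...   | x , refl = begin
  lexBound (suc n) (n + x)                        ≡⟨ lexBound-suc-+ n x ⟩
  lexBound n x + choose2 n + x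
    ≤⟨ +-mono-≤ (+-monoˡ-≤ (choose2 n) (lexBound≤weightSum-L n x x≤choose2)) (edgeSum-L-≥ n x x≤choose2) ⟩
  weightSum (L n x) + choose2 n + edgeSum (L n x)
    ≡⟨ xy∙z≈yz∙x (weightSum (L n x)) (choose2 n) (edgeSum (L n x)) ⟩
  (choose2 n + edgeSum (L n x)) + weightSum (L n x)
    ≡⟨ sym (cong₂ _+_ (weightAt-L-full n x) (cong (λ t → weightSum (L n t)) (m+n∸m≡n n x))) ⟩
  weightAt (L (suc n) (n + x)) zero + weightSum (L n (n + x ∸ n))  ≡⟨ sym (weightSum-L-suc n (n + x)) ⟩
  weightSum (L (suc n) (n + x)) ∎
  where
  open ≤-Reasoning
  x≤choose2 : x ≤ choose2 n
  x≤choose2 = +-cancelˡ-≤ n x (choose2 n) m≤choose2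

weightSum≤lexBound : ∀ n (G : Graph n) → weightSum G ≤ lexBound n (edgeSum G)
weightSum≤lexBound zero    G = z≤n
weightSum≤lexBound (suc n) G with maxDegreeVertex G
... | v , avg = begin
  weightSum G                                  ≡⟨ weightSum-removeVertex G v ⟩
  weightAt G v + weightSum H                   ≤⟨ +-mono-≤ (weightAt≤ G v) (weightSum≤lexBound n H) ⟩
  choose2 (degree G v) + e + lexBound n e      ≡⟨ xy∙z≈zx∙y (choose2 (degree G v)) e (lexBound n e) ⟩
  lexBound n e + choose2 (degree G v) + e      ≤⟨ lexBound-addVertex n (degree G v) e (degree≤ G v) avg ⟩
  lexBound (suc n) (degree G v + e)            ≡⟨ cong (lexBound (suc n)) (sym (edgeSum-removeVertex G v)) ⟩
  lexBound (suc n) (edgeSum G) ∎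
  where
  open ≤-Reasoning
  H : Graph n
  H = removeVertex G v
  e : ℕ
  e = edgeSum H

mainTheorem5 : (n m : ℕ) (G : Graph n) → edgeCount G ≡ m → μ G ≤ μ (L n m)
mainTheorem5 n .(edgeCount G) G refl = begin
  μ G                              ≡⟨ μ≡weightSum G ⟩
  weightSum G                      ≤⟨ weightSum≤lexBound n G ⟩
  lexBound n (edgeSum G)           ≡⟨ cong (lexBound n) (sym (edgeCount≡edgeSum G)) ⟩
  lexBound n (edgeCount G)         ≤⟨ lexBound≤weightSum-L n (edgeCount G) m≤choose2 ⟩
  weightSum (L n (edgeCount G))    ≡⟨ sym (μ≡weightSum (L n (edgeCount G))) ⟩
  μ (L n (edgeCount G)) ∎
  where
  open ≤-Reasoning
  m≤choose2 : edgeCount G ≤ choose2 n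
  m≤choose2 = subst (_≤ choose2 n) (sym (edgeCount≡edgeSum G)) (edgeSum≤choose2 G)
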